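{- Suppose $r,m,\ell,h,p,q$ are nonnegative integers satisfying the following conditions: $h<2^{\ell-2}$; $rm=p\cdot 2^{\ell+1}+2^{\ell-1}+h$; $(r+1)m\leq p\cdot 2^{\ell+1}+5\cdot 2^{\ell-2}$; $(r+2^{\ell-2})m=q\cdot 2^{\ell+1}+3\cdot 2^{\ell-2}+h$; and ${\bf t}_{p+1}\neq{\bf t}_{q+1}$. Then $\langle rm+1,(r+1)m\rangle=\langle (r+2^{\ell-2})m+1,(r+2^{\ell-2}+1)m\rangle$, and $\mathfrak K(m)\leq r+2^{\ell-2}+1$.
   Context: The Thue-Morse word is the infinite binary word ${\bf t}={\bf t}_1{\bf t}_2{\bf t}_3\cdots$, where ${\bf t}_i\in\{0,1\}$ has the same parity as the number of $1$'s in the binary expansion of $i-1$. For positive integers $\alpha\leq\beta$, $\langle\alpha,\beta\rangle$ denotes the factor ${\bf t}_\alpha{\bf t}_{\alpha+1}\cdots{\bf t}_\beta$. A $k$-anti-power is a word of the form $w_1w_2\cdots w_k$ where $w_1,\ldots,w_k$ are pairwise distinct words all of the same length. For a positive integer $m$, $\mathfrak K(m)$ denotes the smallest positive integer $k$ such that the prefix of ${\bf t}$ of length $km$ is not a $k$-anti-power. -}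

module Defs where

open import Data.Nat using (ℕ; zero; suc; _+_; _*_; _∸_; _/_; _%_)
open import Data.Bool using (Bool; true; false; not)
open import Data.List using (List; []; _∷_; map)
open import Relation.Binary.PropositionalEquality using (_≡_)
open import Relation.Nullary using (¬_)
open import Data.Nat using (_≤_; _<_)
open import Data.Product using (∃-syntax; _×_)

-- parity of the number of 1's in the binary expansion of n
-- (fuel-based; fuel n suffices since n/2 < n for n ≥ 1)
bitParityAux : ℕ → ℕ → Bool
bitParityAux zero    n = false
bitParityAux (suc f) zero = false
bitParityAux (suc f) n@(suc _) with n % 2
... | zero  = bitParityAux f (n / 2)
... | suc _ = not (bitParityAux f (n / 2))

bitParity : ℕ → Bool
bitParity n = bitParityAux n n

-- Thue–Morse word, 1-indexed: t i = parity of number of 1's of (i-1);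
-- false = 0, true = 1.  (t 0 is a junk value, never used.)
t : ℕ → Bool
t i = bitParity (i ∸ 1)

range : ℕ → ℕ → List ℕ
range a zero    = []
range a (suc n) = a ∷ range (suc a) n

-- factor ⟨α, β⟩ = t_α t_{α+1} ... t_β  (empty if β < α)
factor : ℕ → ℕ → List Bool
factor α β = map t (range α (suc β ∸ α))

block : ℕ → ℕ → List Bool
block m i = factor ((i ∸ 1) * m + 1) (i * m)

IsAntiPowerPrefix : ℕ → ℕ → Set
IsAntiPowerPrefix m k =
  ∀ i j → 1 ≤ i → i ≤ k → 1 ≤ j → j ≤ k → i ≢ j → ¬ (block m i ≡ block m j)
  where
    _≢_ : ℕ → ℕ → Set
    a ≢ b = ¬ (a ≡ b)

-- 𝔎(m) ≤ K : the least positive k such that the prefix of length k m is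
-- not a k-anti-power is at most K, i.e. some such k lies in [1, K].
KLe : ℕ → ℕ → Set
KLe m K = ∃[ k ] (1 ≤ k × k ≤ K × ¬ IsAntiPowerPrefix m k)

-- Write τ(n) = bitParity n, so that t_{n+1} = τ(n), and a = 2^(ℓ-2).  The hypotheses say
-- rm = a(8p+2) + h and (r+a)m = a(8q+3) + h, and give h + m ≤ 3a.  For j < m write h + j = d·a + y
-- with d < 3 and y < a.  Since τ(2^l·c + y) = τ(c) xor τ(y) for y < 2^l (the binary expansions
-- concatenate), the letters at offset j of the two blocks are τ(p) xor τ(2+d) xor τ(y) and
-- τ(q) xor τ(3+d) xor τ(y).  As τ(p) ≠ τ(q) and τ(2+d) ≠ τ(3+d) for d = 0, 1, 2, they agree, so
-- blocks r+1 and r+a+1 of the prefix coincide.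

module Submission where

open import Defs
open import Data.Nat using (ℕ; _+_; _*_; _∸_; _^_; _≤_; _<_)
open import Data.Product using (_×_)
open import Relation.Binary.PropositionalEquality using (_≡_)
open import Relation.Nullary using (¬_)

open import Data.Nat using (zero; suc; _/_; _%_; NonZero; z≤n; s≤s; s≤s⁻¹)
open import Data.Nat.Properties
open import Data.Nat.DivMod
open import Data.Nat.Tactic.RingSolver using (solve-∀)
open import Data.Bool using (true; false; not; _xor_)
open import Data.Bool.Properties using (xor-assoc; xor-comm; xor-identityʳ; not-involutive)
open import Data.List using (_∷_; map)
open import Data.Product using (_,_)
open import Relation.Binary.PropositionalEquality
  using (_≢_; refl; sym; trans; cong; cong₂; subst; subst₂; module ≡-Reasoning)
open import Relation.Nullary using (contradiction)

open ≡-Reasoning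

bitParityAux-zero : ∀ f → bitParityAux f 0 ≡ false
bitParityAux-zero zero    = refl
bitParityAux-zero (suc f) = refl

bitParityAux-digit : ∀ f n →
  bitParityAux (suc f) (suc n) ≡ bitParityAux f (suc n / 2) xor bitParity (suc n % 2)
bitParityAux-digit f n with suc n % 2 | m%n<n (suc n) 2
... | 0           | _                 = sym (xor-identityʳ _)
... | 1           | _                 = sym (xor-comm _ true)
... | suc (suc _) | s≤s (s≤s ())

half-suc≤ : ∀ n → suc n / 2 ≤ n
half-suc≤ n = s≤s⁻¹ (m/n<m (suc n) 2 (s≤s (s≤s z≤n)))

bitParityAux-fuel : ∀ {f g} n → n ≤ f → n ≤ g → bitParityAux f n ≡ bitParityAux g n
bitParityAux-fuel {f} {g} zero _ _ = trans (bitParityAux-zero f) (sym (bitParityAux-zero g))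
bitParityAux-fuel {suc f} {suc g} (suc n) (s≤s n≤f) (s≤s n≤g) = begin
  bitParityAux (suc f) (suc n)                      ≡⟨ bitParityAux-digit f n ⟩
  bitParityAux f (suc n / 2) xor bitParity (suc n % 2)
    ≡⟨ cong (_xor bitParity (suc n % 2)) (bitParityAux-fuel (suc n / 2) (≤-trans half n≤f) (≤-trans half n≤g)) ⟩
  bitParityAux g (suc n / 2) xor bitParity (suc n % 2) ≡⟨ bitParityAux-digit g n ⟨
  bitParityAux (suc g) (suc n)                      ∎
  where half = half-suc≤ n

bitParity-halve : ∀ x → bitParity x ≡ bitParity (x / 2) xor bitParity (x % 2)
bitParity-halve zero    = refl
bitParity-halve (suc n) = trans (bitParityAux-digit n n)
  (cong (_xor bitParity (suc n % 2)) (bitParityAux-fuel (suc n / 2) (half-suc≤ n) ≤-refl))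

bitParity-+*2 : ∀ {b} k → b < 2 → bitParity (b + k * 2) ≡ bitParity k xor bitParity b
bitParity-+*2 {b} k b<2 = trans (bitParity-halve (b + k * 2))
  (cong₂ (λ u v → bitParity u xor bitParity v) quotient remainder)
  where
  b%2≡b : b % 2 ≡ b
  b%2≡b = m<n⇒m%n≡m b<2
  remainder : (b + k * 2) % 2 ≡ b
  remainder = trans ([m+kn]%n≡m%n b k 2) b%2≡b
  no-carry : b % 2 + k * 2 % 2 < 2
  no-carry = subst (_< 2) (sym (trans (cong₂ _+_ b%2≡b (m*n%n≡0 k 2)) (+-identityʳ b))) b<2
  quotient : (b + k * 2) / 2 ≡ k
  quotient = trans (+-distrib-/ b (k * 2) no-carry) (cong₂ _+_ (m<n⇒m/n≡0 b<2) (m*n/n≡m k 2))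

bitParity-concat : ∀ l c {y} → y < 2 ^ l → bitParity (2 ^ l * c + y) ≡ bitParity c xor bitParity y
bitParity-concat zero    c {zero} _ =
  trans (cong bitParity (trans (+-identityʳ (1 * c)) (*-identityˡ c))) (sym (xor-identityʳ _))
bitParity-concat zero    c {suc _} (s≤s ())
bitParity-concat (suc l) c {y} y<2a = begin
  bitParity (2 * a * c + y)                                ≡⟨ cong bitParity regroup ⟩
  bitParity (y % 2 + (a * c + y / 2) * 2)                  ≡⟨ bitParity-+*2 (a * c + y / 2) (m%n<n y 2) ⟩
  bitParity (a * c + y / 2) xor bitParity (y % 2)          ≡⟨ cong (_xor bitParity (y % 2)) (bitParity-concat l c y/2<a) ⟩
  (bitParity c xor bitParity (y / 2)) xor bitParity (y % 2) ≡⟨ xor-assoc (bitParity c) _ _ ⟩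
  bitParity c xor (bitParity (y / 2) xor bitParity (y % 2)) ≡⟨ cong (bitParity c xor_) (bitParity-halve y) ⟨
  bitParity c xor bitParity y                              ∎
  where
  a = 2 ^ l
  regroup : 2 * a * c + y ≡ y % 2 + (a * c + y / 2) * 2
  regroup = begin
    2 * a * c + y                     ≡⟨ cong (2 * a * c +_) (m≡m%n+[m/n]*n y 2) ⟩
    2 * a * c + (y % 2 + y / 2 * 2)   ≡⟨ shuffle a c (y % 2) (y / 2) ⟩
    y % 2 + (a * c + y / 2) * 2       ∎
    where
    shuffle : ∀ a c r d → 2 * a * c + (r + d * 2) ≡ r + (a * c + d) * 2
    shuffle = solve-∀
  y/2<a : y / 2 < a
  y/2<a = m<n*o⇒m/o<n (subst (y <_) (*-comm 2 a) y<2a)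

≢⇒xor-not≡xor : ∀ {x y} → x ≢ y → ∀ b → x xor not b ≡ y xor b
≢⇒xor-not≡xor {true}  {true}  x≢y _ = contradiction refl x≢y
≢⇒xor-not≡xor {true}  {false} _   b = not-involutive b
≢⇒xor-not≡xor {false} {true}  _   _ = refl
≢⇒xor-not≡xor {false} {false} x≢y _ = contradiction refl x≢y

bitParity[2+d]≡not[bitParity[3+d]] : ∀ {d} → d < 3 → bitParity (2 + d) ≡ not (bitParity (3 + d))
bitParity[2+d]≡not[bitParity[3+d]] {0} _ = refl
bitParity[2+d]≡not[bitParity[3+d]] {1} _ = refl
bitParity[2+d]≡not[bitParity[3+d]] {2} _ = refl
bitParity[2+d]≡not[bitParity[3+d]] {suc (suc (suc _))} (s≤s (s≤s (s≤s ())))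

bitParity[8p+2+d]≡bitParity[8q+3+d] : ∀ p q {d} → bitParity p ≢ bitParity q → d < 3 →
  bitParity (8 * p + (2 + d)) ≡ bitParity (8 * q + (3 + d))
bitParity[8p+2+d]≡bitParity[8q+3+d] p q {d} p≢q d<3 = begin
  bitParity (8 * p + (2 + d))                  ≡⟨ bitParity-concat 3 p (<-≤-trans (+-monoʳ-< 2 d<3) (m≤m+n 5 3)) ⟩
  bitParity p xor bitParity (2 + d)            ≡⟨ cong (bitParity p xor_) (bitParity[2+d]≡not[bitParity[3+d]] d<3) ⟩
  bitParity p xor not (bitParity (3 + d))      ≡⟨ ≢⇒xor-not≡xor p≢q (bitParity (3 + d)) ⟩
  bitParity q xor bitParity (3 + d)            ≡⟨ bitParity-concat 3 q (<-≤-trans (+-monoʳ-< 3 d<3) (m≤m+n 6 2)) ⟨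
  bitParity (8 * q + (3 + d))                  ∎

bitParity-window : ∀ l p q {z} → bitParity p ≢ bitParity q → z < 3 * 2 ^ l →
  bitParity (2 ^ l * (8 * p + 2) + z) ≡ bitParity (2 ^ l * (8 * q + 3) + z)
bitParity-window l p q {z} p≢q z<3a = begin
  bitParity (a * (8 * p + 2) + z)               ≡⟨ split p 2 ⟩
  bitParity (8 * p + (2 + d)) xor bitParity y   ≡⟨ cong (_xor bitParity y) (bitParity[8p+2+d]≡bitParity[8q+3+d] p q p≢q d<3) ⟩
  bitParity (8 * q + (3 + d)) xor bitParity y   ≡⟨ split q 3 ⟨
  bitParity (a * (8 * q + 3) + z)               ∎
  where
  a = 2 ^ l
  instance a≢0 : NonZero a
  a≢0 = m^n≢0 2 l
  d = z / a
  y = z % a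
  d<3 : d < 3
  d<3 = m<n*o⇒m/o<n z<3a
  split : ∀ n c → bitParity (a * (8 * n + c) + z) ≡ bitParity (8 * n + (c + d)) xor bitParity y
  split n c = begin
    bitParity (a * (8 * n + c) + z)          ≡⟨ cong (λ w → bitParity (a * (8 * n + c) + w)) (m≡m%n+[m/n]*n z a) ⟩
    bitParity (a * (8 * n + c) + (y + d * a)) ≡⟨ cong bitParity (carry a n c y d) ⟩
    bitParity (a * (8 * n + (c + d)) + y)    ≡⟨ bitParity-concat l (8 * n + (c + d)) (m%n<n z a) ⟩
    bitParity (8 * n + (c + d)) xor bitParity y ∎
    where
    carry : ∀ a n c y d → a * (8 * n + c) + (y + d * a) ≡ a * (8 * n + (c + d)) + y
    carry = solve-∀

t-suc : ∀ {x n} → x ≡ suc n → t x ≡ bitParity n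
t-suc refl = refl

map-range-cong : ∀ {A : Set} (f : ℕ → A) {a b} n → (∀ {j} → j < n → f (a + j) ≡ f (b + j)) →
  map f (range a n) ≡ map f (range b n)
map-range-cong f zero _ = refl
map-range-cong f {a} {b} (suc n) agree = cong₂ _∷_ head (map-range-cong f n tail)
  where
  head : f a ≡ f b
  head = trans (cong f (sym (+-identityʳ a))) (trans (agree (s≤s z≤n)) (cong f (+-identityʳ b)))
  tail : ∀ {j} → j < n → f (suc a + j) ≡ f (suc b + j)
  tail {j} j<n = trans (cong f (sym (+-suc a j))) (trans (agree (s≤s j<n)) (cong f (+-suc b j)))

factor-range : ∀ a m → factor (a + 1) (a + m) ≡ map t (range (a + 1) m)
factor-range a m = cong (λ n → map t (range (a + 1) n))
  (trans (cong (suc (a + m) ∸_) (+-comm a 1)) (m+n∸m≡n a m))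

factor-cong : ∀ {a b} m → (∀ {j} → j < m → bitParity (a + j) ≡ bitParity (b + j)) →
  factor (a + 1) (a + m) ≡ factor (b + 1) (b + m)
factor-cong {a} {b} m agree = begin
  factor (a + 1) (a + m)    ≡⟨ factor-range a m ⟩
  map t (range (a + 1) m)   ≡⟨ map-range-cong t m shifted ⟩
  map t (range (b + 1) m)   ≡⟨ factor-range b m ⟨
  factor (b + 1) (b + m)    ∎
  where
  +1+ : ∀ x j → x + 1 + j ≡ suc (x + j)
  +1+ x j = trans (+-assoc x 1 j) (+-suc x j)
  shifted : ∀ {j} → j < m → t (a + 1 + j) ≡ t (b + 1 + j)
  shifted {j} j<m = trans (t-suc (+1+ a j)) (trans (agree j<m) (sym (t-suc (+1+ b j))))

[m+1]*n≡m*n+n : ∀ r m → (r + 1) * m ≡ r * m + m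
[m+1]*n≡m*n+n = solve-∀

equal-factors : ∀ l r m p q {h} → bitParity p ≢ bitParity q →
  r * m ≡ 2 ^ l * (8 * p + 2) + h →
  (r + 1) * m ≤ 2 ^ l * (8 * p + 5) →
  (r + 2 ^ l) * m ≡ 2 ^ l * (8 * q + 3) + h →
  factor (r * m + 1) ((r + 1) * m) ≡ factor ((r + 2 ^ l) * m + 1) ((r + 2 ^ l + 1) * m)
equal-factors l r m p q {h} p≢q rm≡ [r+1]m≤ [r+a]m≡ = begin
  factor (r * m + 1) ((r + 1) * m)             ≡⟨ cong (factor (r * m + 1)) ([m+1]*n≡m*n+n r m) ⟩
  factor (r * m + 1) (r * m + m)               ≡⟨ factor-cong m agree ⟩
  factor ((r + a) * m + 1) ((r + a) * m + m)   ≡⟨ cong (factor ((r + a) * m + 1)) ([m+1]*n≡m*n+n (r + a) m) ⟨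
  factor ((r + a) * m + 1) ((r + a + 1) * m)   ∎
  where
  a = 2 ^ l
  offset : ∀ {x} c → x ≡ a * c + h → ∀ j → x + j ≡ a * c + (h + j)
  offset c x≡ j = trans (cong (_+ j) x≡) (+-assoc (a * c) h j)
  h+m≤3a : h + m ≤ 3 * a
  h+m≤3a = +-cancelˡ-≤ (a * (8 * p + 2)) (h + m) (3 * a)
    (subst₂ _≤_ (trans ([m+1]*n≡m*n+n r m) (offset (8 * p + 2) rm≡ m)) (three-more a p) [r+1]m≤)
    where
    three-more : ∀ a p → a * (8 * p + 5) ≡ a * (8 * p + 2) + 3 * a
    three-more = solve-∀
  agree : ∀ {j} → j < m → bitParity (r * m + j) ≡ bitParity ((r + a) * m + j)
  agree {j} j<m = begin
    bitParity (r * m + j)                   ≡⟨ cong bitParity (offset (8 * p + 2) rm≡ j) ⟩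
    bitParity (a * (8 * p + 2) + (h + j))   ≡⟨ bitParity-window l p q p≢q (<-≤-trans (+-monoʳ-< h j<m) h+m≤3a) ⟩
    bitParity (a * (8 * q + 3) + (h + j))   ≡⟨ cong bitParity (offset (8 * q + 3) [r+a]m≡ j) ⟨
    bitParity ((r + a) * m + j)             ∎

block-+1 : ∀ m i → block m (i + 1) ≡ factor (i * m + 1) ((i + 1) * m)
block-+1 m i = cong (λ k → factor (k * m + 1) ((i + 1) * m)) (m+n∸n≡m i 1)

repeated-block⇒KLe : ∀ {m i j} → 1 ≤ i → i < j → block m i ≡ block m j → KLe m j
repeated-block⇒KLe {i = i} {j} 1≤i i<j same =
  j , 1≤j , ≤-refl , λ antipower → antipower i j 1≤i (<⇒≤ i<j) 1≤j ≤-refl (<⇒≢ i<j) same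
  where 1≤j = ≤-trans 1≤i (<⇒≤ i<j)

period-split : ∀ l n c → n * 2 ^ (2 + l + 1) + c * 2 ^ l ≡ 2 ^ l * (8 * n + c)
period-split l n c = begin
  n * (2 * (2 * 2 ^ (l + 1))) + c * 2 ^ l   ≡⟨ cong (λ x → n * (2 * (2 * x)) + c * 2 ^ l) 2^[l+1] ⟩
  n * (2 * (2 * (2 * 2 ^ l))) + c * 2 ^ l   ≡⟨ regroup n c (2 ^ l) ⟩
  2 ^ l * (8 * n + c)                       ∎
  where
  2^[l+1] : 2 ^ (l + 1) ≡ 2 * 2 ^ l
  2^[l+1] = cong (2 ^_) (+-comm l 1)
  regroup : ∀ n c a → n * (2 * (2 * (2 * a))) + c * a ≡ a * (8 * n + c)
  regroup = solve-∀

lemma1 : (r m ℓ h p q : ℕ) → 2 ≤ ℓ →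
    h < 2 ^ (ℓ ∸ 2) →
    r * m ≡ p * 2 ^ (ℓ + 1) + 2 ^ (ℓ ∸ 1) + h →
    (r + 1) * m ≤ p * 2 ^ (ℓ + 1) + 5 * 2 ^ (ℓ ∸ 2) →
    (r + 2 ^ (ℓ ∸ 2)) * m ≡ q * 2 ^ (ℓ + 1) + 3 * 2 ^ (ℓ ∸ 2) + h →
    ¬ (t (p + 1) ≡ t (q + 1)) →
    (factor (r * m + 1) ((r + 1) * m)
       ≡ factor ((r + 2 ^ (ℓ ∸ 2)) * m + 1) ((r + 2 ^ (ℓ ∸ 2) + 1) * m))
    × KLe m (r + 2 ^ (ℓ ∸ 2) + 1)
lemma1 r m (suc zero) h p q (s≤s ()) _ _ _ _ _
lemma1 r m (suc (suc l)) h p q _ _ rm≡ [r+1]m≤ [r+a]m≡ tp≢tq =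
  same-factor , repeated-block⇒KLe (m≤n+m 1 r) (+-monoˡ-< 1 (m<m+n r (m^n>0 2 l))) same-block
  where
  a = 2 ^ l
  p≢q : bitParity p ≢ bitParity q
  p≢q eq = tp≢tq (trans (t-suc (+-comm p 1)) (trans eq (sym (t-suc (+-comm q 1)))))
  same-factor : factor (r * m + 1) ((r + 1) * m) ≡ factor ((r + a) * m + 1) ((r + a + 1) * m)
  same-factor = equal-factors l r m p q p≢q
    (trans rm≡ (cong (_+ h) (period-split l p 2)))
    (≤-trans [r+1]m≤ (≤-reflexive (period-split l p 5)))
    (trans [r+a]m≡ (cong (_+ h) (period-split l q 3)))
  same-block : block m (r + 1) ≡ block m (r + a + 1)
  same-block = trans (block-+1 m r) (trans same-factor (sym (block-+1 m (r + a))))
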